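{- Let $1\le t\le k$ and let $f_t:W\to W$ be the group automorphism with $f_t(s_i)=s_{i+t}$ for $i\in I$. For any $\lambda\in\mathcal{P}^k$, \[ w_{R_t\cup\lambda}=f_t(w_\lambda)\,w_{R_t}. \]
   Context: Fix a positive integer $k$. Let $I=\mathbb{Z}/(k+1)\mathbb{Z}=\{0,1,\dots,k\}$ and let $W=\tilde S_{k+1}$ be the affine symmetric group with Coxeter generators $s_i$ ($i\in I$), relations $s_i^2=1$, $s_is_{i+1}s_i=s_{i+1}s_is_{i+1}$, and $s_is_j=s_js_i$ when $i-j\not\equiv 0,\pm1 \pmod{k+1}$ (indices mod $k+1$). $\mathcal{P}^k$ is the set of partitions with $\lambda_1\le k$. The residue of the cell in row $i$, column $j$ is $j-i\bmod(k+1)$; $w_\lambda=s_{i_1}\cdots s_{i_l}$ where $(i_1,\dots,i_l)$ are the residues of the cells of $\lambda$ read from the shortest row to the longest, each row from right to left. $R_t=(t^{k+1-t})$ ($k+1-t$ parts equal to $t$), and $R_t\cup\lambda$ is the partition whose parts are those of $R_t$ and $\lambda$ together, sorted in weakly decreasing order. -}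

module Defs where

open import Data.Nat using (ℕ; zero; suc; _+_; _*_; _∸_; _≤_; _≥_; _≤?_)
open import Data.Nat.DivMod using (_mod_)
open import Data.Fin using (Fin; toℕ)
open import Data.List using (List; []; _∷_; _++_; map)
open import Data.List.Relation.Unary.All using (All)
open import Data.List.Relation.Unary.Linked using (Linked)
open import Data.Product using (_×_)
open import Relation.Nullary using (yes; no)
open import Relation.Binary.PropositionalEquality using (_≢_)

-- Residues I = ℤ/(k+1)ℤ, represented by Fin (suc k).
Res : ℕ → Set
Res k = Fin (suc k)

shiftRes : (k : ℕ) → ℕ → Res k → Res k
shiftRes k t i = (toℕ i + t) mod (suc k)

next : (k : ℕ) → Res k → Res k
next k = shiftRes k 1

-- Words in the Coxeter generators s_0,…,s_k of the affine symmetric group.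
Word : ℕ → Set
Word k = List (Res k)

-- The congruence on words generated by the Coxeter relations of W = S̃_{k+1}.
-- W is the set of words modulo this congruence, product = concatenation.
-- (The braid relation s_i s_{i+1} s_i = s_{i+1} s_i s_{i+1} is imposed for
-- k ≥ 2; for k = 1, S̃_2 is infinite dihedral, m(s_0,s_1) = ∞.)
data _≈[_]_ : {k : ℕ} → Word k → (k' : ℕ) → Word k → Set where
  ≈refl  : ∀ {k} {u : Word k} → u ≈[ k ] u
  ≈sym   : ∀ {k} {u v : Word k} → u ≈[ k ] v → v ≈[ k ] u
  ≈trans : ∀ {k} {u v w : Word k} → u ≈[ k ] v → v ≈[ k ] w → u ≈[ k ] w
  ≈ctx   : ∀ {k} (a b : Word k) {u v : Word k} → u ≈[ k ] v →
           (a ++ u ++ b) ≈[ k ] (a ++ v ++ b)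
  ≈quad  : ∀ {k} (i : Res k) → (i ∷ i ∷ []) ≈[ k ] []
  ≈braid : ∀ {k} → 2 ≤ k → (i : Res k) →
           (i ∷ next k i ∷ i ∷ []) ≈[ k ] (next k i ∷ i ∷ next k i ∷ [])
  ≈comm  : ∀ {k} (i j : Res k) → j ≢ i → j ≢ next k i → i ≢ next k j →
           (i ∷ j ∷ []) ≈[ k ] (j ∷ i ∷ [])

fWord : (k t : ℕ) → Word k → Word k
fWord k t = map (shiftRes k t)

IsKPartition : ℕ → List ℕ → Set
IsKPartition k λ' = Linked _≥_ λ' × All (λ x → 1 ≤ x × x ≤ k) λ'

-- Residue of the cell in row i, column j (1-based): j - i mod (k+1),
-- computed as (j + k·i) mod (k+1).
residue : (k i j : ℕ) → Res k
residue k i j = (j + k * i) mod (suc k)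

rowWord : (k i l : ℕ) → Word k
rowWord k i zero = []
rowWord k i (suc j) = residue k i (suc j) ∷ rowWord k i j

-- Reading rows from the last (shortest) to the first (longest), starting at row i.
readRows : (k i : ℕ) → List ℕ → Word k
readRows k i [] = []
readRows k i (l ∷ ls) = readRows k (suc i) ls ++ rowWord k i l

wOf : (k : ℕ) → List ℕ → Word k
wOf k λ' = readRows k 1 λ'

insertDec : ℕ → List ℕ → List ℕ
insertDec x [] = x ∷ []
insertDec x (y ∷ ys) with y ≤? x
... | yes _ = x ∷ y ∷ ys
... | no _  = y ∷ insertDec x ys

-- μ ∪ λ: add m copies of x to λ (sorted weakly decreasing)
addCopies : ℕ → ℕ → List ℕ → List ℕ
addCopies zero x λ' = λ'
addCopies (suc m) x λ' = insertDec x (addCopies m x λ')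

R : ℕ → ℕ → List ℕ
R k t = addCopies (suc k ∸ t) t []

RUnion : ℕ → ℕ → List ℕ → List ℕ
RUnion k t λ' = addCopies (suc k ∸ t) t λ'

-- Reading R_t ∪ λ from its shortest row, the rows of λ of length at most t come
-- first: they are the rows of λ pushed down by h = k + 1 − t, which shifts every
-- residue by −h ≡ t, i.e. applies f_t. Then come the h rows of the rectangle, and
-- then the rows of λ of length q + t > t, which f_t(w_λ) w_{R_t} wants in front of
-- the rectangle instead. Such a row is moved across the rectangle: its cells in the
-- first t columns extend the rectangle by a row on top, the bottom row of the
-- enlarged rectangle becomes the first t cells of the moved row, and the letter s_j
-- of each of its other q cells travels through the rectangle and comes out as
-- s_{j+t}.

module Submission where

open import Defs
open import Data.Nat using (ℕ; zero; suc; _+_; _*_; _∸_; _≤_; _<_; z≤n; s≤s; _%_; _≤?_; _<?_)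
open import Data.Nat.Properties
open import Data.Nat.DivMod
open import Data.Nat.Tactic.RingSolver using (solve-∀)
open import Data.Fin using (toℕ)
open import Data.Fin.Properties using (toℕ-injective; toℕ-fromℕ<)
open import Data.List using (List; []; _∷_; _++_; replicate; length; head)
open import Data.List.Properties using (++-assoc; ++-identityʳ; map-++; length-replicate)
open import Data.List.Relation.Unary.All as All using (All; _∷_)
import Data.Maybe.Relation.Unary.All as Maybe
open import Data.Product using (_,_; proj₂)
open import Data.Empty using (⊥-elim)
open import Level using (0ℓ)
open import Relation.Nullary using (yes; no; ¬_)
open import Relation.Binary.Bundles using (Setoid)
open import Relation.Binary.Structures using (IsEquivalence)
open import Relation.Binary.PropositionalEquality
import Relation.Binary.Reasoning.Setoid as SetoidReasoning

insertDec-≤head : ∀ x ys → Maybe.All (_≤ x) (head ys) → insertDec x ys ≡ x ∷ ys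
insertDec-≤head x []       _                = refl
insertDec-≤head x (y ∷ ys) (Maybe.just y≤x) with y ≤? x
... | yes _  = refl
... | no y≰x = ⊥-elim (y≰x y≤x)

addCopies-≤head : ∀ m x ys → Maybe.All (_≤ x) (head ys) →
                  addCopies m x ys ≡ replicate m x ++ ys
addCopies-≤head zero    x ys ys≤x = refl
addCopies-≤head (suc m) x ys ys≤x =
  trans (cong (insertDec x) (addCopies-≤head m x ys ys≤x)) (insertDec-≤head x _ (head≤x m))
  where
  head≤x : ∀ m → Maybe.All (_≤ x) (head (replicate m x ++ ys))
  head≤x zero    = ys≤x
  head≤x (suc m) = Maybe.just ≤-refl

addCopies-<head : ∀ m x p ys → x < p → addCopies m x (p ∷ ys) ≡ p ∷ addCopies m x ys
addCopies-<head zero    x p ys x<p = refl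
addCopies-<head (suc m) x p ys x<p rewrite addCopies-<head m x p ys x<p with p ≤? x
... | yes p≤x = ⊥-elim (<⇒≱ x<p p≤x)
... | no _    = refl

readRows-++ : ∀ k i xs ys →
              readRows k i (xs ++ ys) ≡ readRows k (i + length xs) ys ++ readRows k i xs
readRows-++ k i []       ys =
  sym (trans (++-identityʳ _) (cong (λ j → readRows k j ys) (+-identityʳ i)))
readRows-++ k i (x ∷ xs) ys = begin
  readRows k (suc i) (xs ++ ys) ++ rowWord k i x
    ≡⟨ cong (_++ rowWord k i x) (readRows-++ k (suc i) xs ys) ⟩
  (readRows k (suc i + length xs) ys ++ readRows k (suc i) xs) ++ rowWord k i x
    ≡⟨ ++-assoc (readRows k (suc i + length xs) ys) _ _ ⟩
  readRows k (suc i + length xs) ys ++ readRows k i (x ∷ xs)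
    ≡⟨ cong (λ j → readRows k j ys ++ readRows k i (x ∷ xs)) (+-suc i (length xs)) ⟨
  readRows k (i + length (x ∷ xs)) ys ++ readRows k i (x ∷ xs)
    ∎
  where open ≡-Reasoning

module Residues (k : ℕ) where

  n : ℕ
  n = suc k

  infix 4 _≡ₘ_
  record _≡ₘ_ (x y : ℕ) : Set where
    constructor mod-≡
    field mod-≡-proof : x % n ≡ y % n
  open _≡ₘ_

  ≡ₘ-isEquivalence : IsEquivalence _≡ₘ_
  ≡ₘ-isEquivalence = record
    { refl  = mod-≡ refl
    ; sym   = λ (mod-≡ p) → mod-≡ (sym p)
    ; trans = λ (mod-≡ p) (mod-≡ q) → mod-≡ (trans p q)
    }

  module ≡ₘ = IsEquivalence ≡ₘ-isEquivalence

  ≡⇒≡ₘ : ∀ {x y} → x ≡ y → x ≡ₘ y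
  ≡⇒≡ₘ refl = ≡ₘ.refl

  +-congʳ-≡ₘ : ∀ {x y} c → x ≡ₘ y → x + c ≡ₘ y + c
  +-congʳ-≡ₘ {x} {y} c (mod-≡ x≡y) = mod-≡ (begin
    (x + c) % n           ≡⟨ %-distribˡ-+ x c n ⟩
    (x % n + c % n) % n   ≡⟨ cong (λ z → (z + c % n) % n) x≡y ⟩
    (y % n + c % n) % n   ≡⟨ %-distribˡ-+ y c n ⟨
    (y + c) % n           ∎)
    where open ≡-Reasoning

  +-congˡ-≡ₘ : ∀ {x y} c → x ≡ₘ y → c + x ≡ₘ c + y
  +-congˡ-≡ₘ {x} {y} c x≡y = subst₂ _≡ₘ_ (+-comm x c) (+-comm y c) (+-congʳ-≡ₘ c x≡y)

  %-≡ₘ : ∀ x → x % n ≡ₘ x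
  %-≡ₘ x = mod-≡ (m%n%n≡m%n x n)

  +n-≡ₘ : ∀ x → x + n ≡ₘ x
  +n-≡ₘ x = mod-≡ ([m+n]%n≡m%n x n)

  +-suc-≡ₘ : ∀ {x y a} → x + a ≡ₘ y → x + suc a ≡ₘ suc y
  +-suc-≡ₘ {x} {y} {a} x+a≡y =
    subst₂ _≡ₘ_ (trans (+-comm (x + a) 1) (sym (+-suc x a))) (+-comm y 1) (+-congʳ-≡ₘ 1 x+a≡y)

  +-complement-≡ₘ : ∀ {x y a b} → a + b ≡ n → x + a ≡ₘ y → y + b ≡ₘ x
  +-complement-≡ₘ {x} {y} {a} {b} a+b≡n x+a≡y =
    ≡ₘ.trans (≡ₘ.sym (+-congʳ-≡ₘ b x+a≡y))
      (≡ₘ.trans (≡⇒≡ₘ (trans (+-assoc x a b) (cong (x +_) a+b≡n))) (+n-≡ₘ x))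

  +-cancelʳ-≡ₘ : ∀ {x y} c → x + c ≡ₘ y + c → x ≡ₘ y
  +-cancelʳ-≡ₘ {x} {y} c x+c≡y+c =
    ≡ₘ.trans (≡ₘ.sym (+c*k x)) (≡ₘ.trans (+-congʳ-≡ₘ (c * k) x+c≡y+c) (+c*k y))
    where
    +c*k : ∀ z → z + c + c * k ≡ₘ z
    +c*k z = ≡ₘ.trans (≡⇒≡ₘ (trans (+-assoc z c (c * k)) (cong (z +_) (sym (*-suc c k)))))
                      (mod-≡ ([m+kn]%n≡m%n z c n))

  %-+-≢ : ∀ {r e} → r < n → 0 < e → e < n → (r + e) % n ≢ r
  %-+-≢ {r} {e} r<n 0<e e<n r+e≡r with r + e <? n
  ... | yes r+e<n =
    <-irrefl refl (subst (r <_) (trans (sym (m<n⇒m%n≡m r+e<n)) r+e≡r) (m<m+n r 0<e))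
  ... | no r+e≮n =
    <-irrefl (+-cancelˡ-≡ r e n (trans (sym (m∸n+n≡m n≤r+e)) (cong (_+ n) wrapped))) e<n
    where
    n≤r+e = ≮⇒≥ r+e≮n
    r+e∸n<n : r + e ∸ n < n
    r+e∸n<n = subst (r + e ∸ n <_) (m+n∸n≡m n n) (∸-monoˡ-< (+-mono-< r<n e<n) n≤r+e)
    wrapped : r + e ∸ n ≡ r
    wrapped = trans (sym (m<n⇒m%n≡m r+e∸n<n)) (trans (m≤n⇒[n∸m]%m≡n%m n≤r+e) r+e≡r)

  +-≢ₘ : ∀ x {e} → 0 < e → e < n → ¬ (x + e ≡ₘ x)
  +-≢ₘ x 0<e e<n x+e≡x =
    %-+-≢ (m%n<n x n) 0<e e<n (mod-≡-proof (≡ₘ.trans (+-congʳ-≡ₘ _ (%-≡ₘ x)) x+e≡x))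

module Words (k : ℕ) where

  open Residues k public

  s : ℕ → Res k
  s x = x mod n

  toℕ-s : ∀ x → toℕ (s x) ≡ x % n
  toℕ-s x = toℕ-fromℕ< (m%n<n x n)

  s-cong : ∀ {x y} → x ≡ₘ y → s x ≡ s y
  s-cong {x} {y} (mod-≡ x≡y) = toℕ-injective (trans (toℕ-s x) (trans x≡y (sym (toℕ-s y))))

  s-injective : ∀ {x y} → s x ≡ s y → x ≡ₘ y
  s-injective {x} {y} sx≡sy = mod-≡ (trans (sym (toℕ-s x)) (trans (cong toℕ sx≡sy) (toℕ-s y)))

  shiftRes-s : ∀ t x → shiftRes k t (s x) ≡ s (x + t)
  shiftRes-s t x = s-cong (+-congʳ-≡ₘ t (≡ₘ.trans (≡⇒≡ₘ (toℕ-s x)) (%-≡ₘ x)))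

  next-s : ∀ x → next k (s x) ≡ s (suc x)
  next-s x = trans (shiftRes-s 1 x) (cong s (+-comm x 1))

  s-gap-≢ : ∀ x {y e} → 0 < e → e < n → x + e ≡ₘ y → s y ≢ s x
  s-gap-≢ x 0<e e<n x+e≡y sy≡sx = +-≢ₘ x 0<e e<n (≡ₘ.trans x+e≡y (s-injective sy≡sx))

  ≈-setoid : Setoid 0ℓ 0ℓ
  ≈-setoid = record
    { Carrier       = Word k
    ; _≈_           = _≈[ k ]_
    ; isEquivalence = record { refl = ≈refl ; sym = ≈sym ; trans = ≈trans }
    }

  open Setoid ≈-setoid public using (_≈_) renaming (reflexive to ≡⇒≈)
  module ≈-Reasoning = SetoidReasoning ≈-setoid

  ++-congˡ : ∀ a {u v} → u ≈ v → a ++ u ≈ a ++ v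
  ++-congˡ a {u} {v} u≈v =
    subst₂ _≈_ (cong (a ++_) (++-identityʳ u)) (cong (a ++_) (++-identityʳ v)) (≈ctx a [] u≈v)

  ++-congʳ : ∀ b {u v} → u ≈ v → u ++ b ≈ v ++ b
  ++-congʳ b = ≈ctx [] b

  s-comm : ∀ {x y a b} → 2 ≤ a → 2 ≤ b → a + b ≡ n → x + a ≡ₘ y →
           s x ∷ s y ∷ [] ≈ s y ∷ s x ∷ []
  s-comm {x} {y} {a@(suc (suc a'))} {b@(suc (suc b'))} (s≤s (s≤s _)) (s≤s (s≤s _)) a+b≡n x+a≡y =
    ≈comm (s x) (s y) y≢x y≢x+1 x≢y+1
    where
    a<n : a < n
    a<n = subst (a <_) a+b≡n (m<m+n a {b} (s≤s z≤n))
    b<n : b < n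
    b<n = subst (b <_) a+b≡n (m<n+m b {a} (s≤s z≤n))
    y≢x : s y ≢ s x
    y≢x = s-gap-≢ x (s≤s z≤n) a<n x+a≡y
    y≢x+1 : s y ≢ next k (s x)
    y≢x+1 rewrite next-s x =
      s-gap-≢ (suc x) (s≤s z≤n) (<-trans (n<1+n _) a<n)
        (≡ₘ.trans (≡⇒≡ₘ (sym (+-suc x (suc a')))) x+a≡y)
    x≢y+1 : s x ≢ next k (s y)
    x≢y+1 rewrite next-s y =
      s-gap-≢ (suc y) (s≤s z≤n) (<-trans (n<1+n _) b<n)
        (≡ₘ.trans (≡⇒≡ₘ (sym (+-suc y (suc b')))) (+-complement-≡ₘ {a = a} {b} a+b≡n x+a≡y))

  s-braid : 2 ≤ k → ∀ x → s x ∷ s (suc x) ∷ s x ∷ [] ≈ s (suc x) ∷ s x ∷ s (suc x) ∷ []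
  s-braid 2≤k x =
    subst (λ y → s x ∷ y ∷ s x ∷ [] ≈ y ∷ s x ∷ y ∷ []) (next-s x) (≈braid 2≤k (s x))

  down : ℕ → ℕ → Word k
  down zero    b = []
  down (suc l) b = s (l + b) ∷ down l b

  down-cong : ∀ l {x y} → x ≡ₘ y → down l x ≡ down l y
  down-cong zero    x≡y = refl
  down-cong (suc l) x≡y = cong₂ _∷_ (s-cong (+-congˡ-≡ₘ l x≡y)) (down-cong l x≡y)

  down-+ : ∀ q l b r → down (q + l) b ++ r ≡ down q (l + b) ++ down l b ++ r
  down-+ zero    l b r = refl
  down-+ (suc q) l b r = cong₂ _∷_ (cong s (+-assoc q l b)) (down-+ q l b r)

  down-suc : ∀ l b r → down (suc l) b ++ r ≡ down l (suc b) ++ s b ∷ r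
  down-suc l b r = trans (cong (λ m → down m b ++ r) (+-comm 1 l)) (down-+ l 1 b r)

  fWord-down : ∀ t l x → fWord k t (down l x) ≡ down l (x + t)
  fWord-down t zero    x = refl
  fWord-down t (suc l) x =
    cong₂ _∷_ (trans (shiftRes-s t (l + x)) (cong s (+-assoc l x t))) (fWord-down t l x)

  s-comm-down : ∀ l {x y a b} → 2 ≤ a → l < b → a + b ≡ n → x + a ≡ₘ y → ∀ r →
                s x ∷ down l y ++ r ≈ down l y ++ s x ∷ r
  s-comm-down zero    _ _ _ _ r = ≈refl
  s-comm-down (suc l) {x} {y} {a} {suc b} 2≤a (s≤s l<b) a+b≡n x+a≡y r = begin
    s x ∷ down (suc l) y ++ r
      ≡⟨ cong (s x ∷_) (down-suc l y r) ⟩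
    s x ∷ down l (suc y) ++ s y ∷ r
      ≈⟨ s-comm-down l {x} {suc y} {suc a} (m≤n⇒m≤1+n 2≤a) l<b
           (trans (sym (+-suc a b)) a+b≡n) (+-suc-≡ₘ x+a≡y) _ ⟩
    down l (suc y) ++ s x ∷ s y ∷ r
      ≈⟨ ++-congˡ (down l (suc y))
           (++-congʳ r (s-comm 2≤a (s≤s (<-≤-trans (s≤s z≤n) l<b)) a+b≡n x+a≡y)) ⟩
    down l (suc y) ++ s y ∷ s x ∷ r
      ≡⟨ down-suc l y (s x ∷ r) ⟨
    down (suc l) y ++ s x ∷ r
      ∎
    where open ≈-Reasoning

  -- Carrying the tail r spares reassociating _++_ in the lemmas below.
  rect : ℕ → ℕ → ℕ → Word k → Word k
  rect t zero    a r = r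
  rect t (suc h) a r = down t a ++ rect t h (suc a) r

  rect-cong : ∀ t h a {u v} → u ≈ v → rect t h a u ≈ rect t h a v
  rect-cong t zero    a u≈v = u≈v
  rect-cong t (suc h) a u≈v = ++-congˡ (down t a) (rect-cong t h (suc a) u≈v)

  rect-+ : ∀ t p q a r → rect t (p + q) a r ≡ rect t p a (rect t q (p + a) r)
  rect-+ t zero    q a r = refl
  rect-+ t (suc p) q a r = cong (down t a ++_)
    (trans (rect-+ t p q (suc a) r) (cong (λ b → rect t p (suc a) (rect t q b r)) (+-suc p a)))

  rect-suc : ∀ t h a r → rect t (suc h) a r ≡ rect t h a (down t (h + a) ++ r)
  rect-suc t h a r = trans (cong (λ m → rect t m a r) (+-comm 1 h)) (rect-+ t h 1 a r)

  s-comm-rect : ∀ t h {x y a b} → 2 ≤ a → h + t ≤ b → a + b ≡ n → x + a ≡ₘ y → ∀ r →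
                s x ∷ rect t h y r ≈ rect t h y (s x ∷ r)
  s-comm-rect t zero    _ _ _ _ r = ≈refl
  s-comm-rect t (suc h) {x} {y} {a} {suc b} 2≤a (s≤s h+t≤b) a+b≡n x+a≡y r = begin
    s x ∷ down t y ++ rect t h (suc y) r
      ≈⟨ s-comm-down t 2≤a (s≤s (≤-trans (m≤n+m t h) h+t≤b)) a+b≡n x+a≡y _ ⟩
    down t y ++ s x ∷ rect t h (suc y) r
      ≈⟨ ++-congˡ (down t y) (s-comm-rect t h {x} {suc y} {suc a} (m≤n⇒m≤1+n 2≤a) h+t≤b
           (trans (sym (+-suc a b)) a+b≡n) (+-suc-≡ₘ x+a≡y) r) ⟩
    down t y ++ rect t h (suc y) (s x ∷ r)
      ∎
    where open ≈-Reasoning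

  s-across-two-rows : 2 ≤ k → ∀ t y {b} → 2 + b ≡ n → t ≤ b → ∀ r →
                      rect t 2 y (s y ∷ r) ≈ s (t + y) ∷ rect t 2 y r
  s-across-two-rows 2≤k zero    y _ _ r = ≈refl
  s-across-two-rows 2≤k (suc t) y {b} 2+b≡n t<b r = begin
    down (suc t) y ++ down (suc t) (suc y) ++ s y ∷ r
      ≡⟨ peel (s y ∷ r) ⟩
    down t (suc y) ++ s y ∷ down t (suc (suc y)) ++ s (suc y) ∷ s y ∷ r
      ≈⟨ ++-congˡ (down t (suc y)) (s-comm-down t {a = 2} ≤-refl t<b 2+b≡n y+2 _) ⟩
    down t (suc y) ++ down t (suc (suc y)) ++ s y ∷ s (suc y) ∷ s y ∷ r
      ≈⟨ ++-congˡ (down t (suc y))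
           (++-congˡ (down t (suc (suc y))) (++-congʳ r (s-braid 2≤k y))) ⟩
    down t (suc y) ++ down t (suc (suc y)) ++ s (suc y) ∷ s y ∷ s (suc y) ∷ r
      ≈⟨ s-across-two-rows 2≤k t (suc y) 2+b≡n (<⇒≤ t<b) _ ⟩
    s (t + suc y) ∷ down t (suc y) ++ down t (suc (suc y)) ++ s y ∷ s (suc y) ∷ r
      ≈⟨ ++-congˡ (s (t + suc y) ∷ down t (suc y))
           (s-comm-down t {a = 2} ≤-refl t<b 2+b≡n y+2 _) ⟨
    s (t + suc y) ∷ down t (suc y) ++ s y ∷ down t (suc (suc y)) ++ s (suc y) ∷ r
      ≡⟨ cong₂ _∷_ (cong s (sym (+-suc t y))) (peel r) ⟨
    s (suc t + y) ∷ down (suc t) y ++ down (suc t) (suc y) ++ r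
      ∎
    where
    open ≈-Reasoning
    y+2 : y + 2 ≡ₘ suc (suc y)
    y+2 = ≡⇒≡ₘ (+-comm y 2)
    peel : ∀ r → down (suc t) y ++ down (suc t) (suc y) ++ r
               ≡ down t (suc y) ++ s y ∷ down t (suc (suc y)) ++ s (suc y) ∷ r
    peel r = trans (down-suc t y _) (cong (λ w → down t (suc y) ++ s y ∷ w) (down-suc t (suc y) r))

  -- s (j + a) commutes with the rows down t (a + m) for m ≥ j + 2, the rows m = j
  -- and m = j + 1 turn it into s (t + (j + a)) by braid moves, and that commutes
  -- with the rows m < j.
  s-across-rect : 2 ≤ k → ∀ t h a j → h + t ≡ n → j + 2 ≤ h → ∀ r →
                  rect t h a (s (j + a) ∷ r) ≈ s (j + (t + a)) ∷ rect t h a r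
  s-across-rect 2≤k t h a j h+t≡n j+2≤h r with m≤n⇒∃[o]m+o≡n j+2≤h
  ... | e , refl = begin
    rect t (j + 2 + e) a (s (j + a) ∷ r)
      ≡⟨ split _ ⟩
    rect t j a (rect t 2 (j + a) (rect t e (j + 2 + a) (s (j + a) ∷ r)))
      ≈⟨ rect-cong t j a (rect-cong t 2 (j + a)
           (s-comm-rect t e ≤-refl (m≤n+m (e + t) j) 2+b≡n (≡⇒≡ₘ (ring₁ j a)) r)) ⟨
    rect t j a (rect t 2 (j + a) (s (j + a) ∷ rect t e (j + 2 + a) r))
      ≈⟨ rect-cong t j a
           (s-across-two-rows 2≤k t (j + a) 2+b≡n (≤-trans (m≤n+m t e) (m≤n+m (e + t) j)) _) ⟩
    rect t j a (s (t + (j + a)) ∷ rect t 2 (j + a) (rect t e (j + 2 + a) r))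
      ≈⟨ s-comm-rect t j {a = 2 + e} {b = j + t} (s≤s (s≤s z≤n)) ≤-refl
           (trans (ring₂ e j t) h+t≡n) x+2+e≡a _ ⟨
    s (t + (j + a)) ∷ rect t j a (rect t 2 (j + a) (rect t e (j + 2 + a) r))
      ≡⟨ cong₂ _∷_ (cong s (ring₄ t j a)) (split r) ⟨
    s (j + (t + a)) ∷ rect t (j + 2 + e) a r
      ∎
    where
    open ≈-Reasoning
    ring₁ : ∀ j a → j + a + 2 ≡ j + 2 + a
    ring₁ = solve-∀
    ring₂ : ∀ e j t → 2 + e + (j + t) ≡ j + 2 + e + t
    ring₂ = solve-∀
    ring₃ : ∀ t j a e → t + (j + a) + (2 + e) ≡ a + (j + 2 + e + t)
    ring₃ = solve-∀
    ring₄ : ∀ t j a → j + (t + a) ≡ t + (j + a)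
    ring₄ = solve-∀
    ring₅ : ∀ j e t → 2 + (j + (e + t)) ≡ j + 2 + e + t
    ring₅ = solve-∀
    2+b≡n : 2 + (j + (e + t)) ≡ n
    2+b≡n = trans (ring₅ j e t) h+t≡n
    x+2+e≡a : t + (j + a) + (2 + e) ≡ₘ a
    x+2+e≡a = ≡ₘ.trans (≡⇒≡ₘ (trans (ring₃ t j a e) (cong (a +_) h+t≡n))) (+n-≡ₘ a)
    split : ∀ r → rect t (j + 2 + e) a r ≡ rect t j a (rect t 2 (j + a) (rect t e (j + 2 + a) r))
    split r = trans (rect-+ t (j + 2) e a r) (rect-+ t j 2 a _)

  down-across-rect : 2 ≤ k → ∀ t h a q → h + t ≡ n → q < h → ∀ r →
                     rect t h a (down q a ++ r) ≈ down q (t + a) ++ rect t h a r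
  down-across-rect 2≤k t h a zero    h+t≡n q<h r = ≈refl
  down-across-rect 2≤k t h a (suc q) h+t≡n q<h r = begin
    rect t h a (s (q + a) ∷ down q a ++ r)
      ≈⟨ s-across-rect 2≤k t h a q h+t≡n (subst (_≤ h) (+-comm 2 q) q<h) _ ⟩
    s (q + (t + a)) ∷ rect t h a (down q a ++ r)
      ≈⟨ ++-congˡ (s (q + (t + a)) ∷ []) (down-across-rect 2≤k t h a q h+t≡n (<⇒≤ q<h) r) ⟩
    s (q + (t + a)) ∷ down q (t + a) ++ rect t h a r
      ∎
    where open ≈-Reasoning

  long-row-across-rect : 2 ≤ k → ∀ t h a q → h + t ≡ n → q < h → ∀ r →
    rect t h a (down (q + t) (h + a) ++ r) ≈ down (q + t) a ++ rect t h (suc a) r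
  long-row-across-rect 2≤k t h a q h+t≡n q<h r = begin
    rect t h a (down (q + t) (h + a) ++ r)
      ≡⟨ cong (rect t h a) (down-+ q t (h + a) r) ⟩
    rect t h a (down q (t + (h + a)) ++ down t (h + a) ++ r)
      ≡⟨ cong (λ w → rect t h a (w ++ down t (h + a) ++ r)) (down-cong q t+start≡h+aa) ⟩
    rect t h a (down q a ++ down t (h + a) ++ r)
      ≈⟨ down-across-rect 2≤k t h a q h+t≡n q<h _ ⟩
    down q (t + a) ++ rect t h a (down t (h + a) ++ r)
      ≡⟨ cong (down q (t + a) ++_) (rect-suc t h a r) ⟨
    down q (t + a) ++ down t a ++ rect t h (suc a) r
      ≡⟨ down-+ q t a _ ⟨
    down (q + t) a ++ rect t h (suc a) r
      ∎
    where
    open ≈-Reasoning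
    ring : ∀ t h a → t + (h + a) ≡ a + (h + t)
    ring = solve-∀
    t+start≡h+aa : t + (h + a) ≡ₘ a
    t+start≡h+aa = ≡ₘ.trans (≡⇒≡ₘ (trans (ring t h a) (cong (a +_) h+t≡n))) (+n-≡ₘ a)

  rowStart : ℕ → ℕ
  rowStart i = suc (k * i)

  rowWord-down : ∀ i l → rowWord k i l ≡ down l (rowStart i)
  rowWord-down i zero    = refl
  rowWord-down i (suc l) = cong₂ _∷_ (cong (_mod n) (sym (+-suc l (k * i)))) (rowWord-down i l)

  rowStart-suc : ∀ i → suc (rowStart (suc i)) ≡ₘ rowStart i
  rowStart-suc i = ≡ₘ.trans (≡⇒≡ₘ (ring k i)) (+n-≡ₘ (rowStart i))
    where
    ring : ∀ k i → suc (suc (k * suc i)) ≡ suc (k * i) + suc k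
    ring = solve-∀

  rowStart-+ : ∀ i h → h + rowStart (i + h) ≡ₘ rowStart i
  rowStart-+ i h = ≡ₘ.trans (≡⇒≡ₘ (ring k i h)) (mod-≡ ([m+kn]%n≡m%n (rowStart i) h n))
    where
    ring : ∀ k i h → h + suc (k * (i + h)) ≡ suc (k * i) + h * suc k
    ring = solve-∀

  readRows-replicate : ∀ t hh i a r → hh + a ≡ₘ suc (rowStart i) →
                       readRows k i (replicate hh t) ++ r ≡ rect t hh a r
  readRows-replicate t zero     i a r _ = refl
  readRows-replicate t (suc hh) i a r next-row = begin
    (readRows k (suc i) (replicate hh t) ++ rowWord k i t) ++ r
      ≡⟨ ++-assoc (readRows k (suc i) (replicate hh t)) _ r ⟩
    readRows k (suc i) (replicate hh t) ++ rowWord k i t ++ r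
      ≡⟨ readRows-replicate t hh (suc i) a _ (≡ₘ.trans last-row (≡ₘ.sym (rowStart-suc i))) ⟩
    rect t hh a (rowWord k i t ++ r)
      ≡⟨ cong (λ w → rect t hh a (w ++ r))
           (trans (rowWord-down i t) (down-cong t (≡ₘ.sym last-row))) ⟩
    rect t hh a (down t (hh + a) ++ r)
      ≡⟨ rect-suc t hh a r ⟨
    rect t (suc hh) a r
      ∎
    where
    open ≡-Reasoning
    last-row : hh + a ≡ₘ rowStart i
    last-row = +-cancelʳ-≡ₘ 1 (subst₂ _≡ₘ_ (+-comm 1 (hh + a)) (+-comm 1 (rowStart i)) next-row)

module Rectangle (k t h : ℕ) (t+h≡n : t + h ≡ suc k) where

  open Words k

  wR : ℕ → Word k
  wR i = readRows k i (replicate h t)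

  h+t≡n : h + t ≡ n
  h+t≡n = trans (+-comm h t) t+h≡n

  fWord-rowWord : ∀ i l → fWord k t (rowWord k i l) ≡ rowWord k (i + h) l
  fWord-rowWord i l = begin
    fWord k t (rowWord k i l)        ≡⟨ cong (fWord k t) (rowWord-down i l) ⟩
    fWord k t (down l (rowStart i))  ≡⟨ fWord-down t l (rowStart i) ⟩
    down l (rowStart i + t)          ≡⟨ down-cong l (+-cancelʳ-≡ₘ h both+h) ⟩
    down l (rowStart (i + h))        ≡⟨ rowWord-down (i + h) l ⟨
    rowWord k (i + h) l              ∎
    where
    open ≡-Reasoning
    both+h : rowStart i + t + h ≡ₘ rowStart (i + h) + h
    both+h =
      ≡ₘ.trans (≡⇒≡ₘ (trans (+-assoc (rowStart i) t h) (cong (rowStart i +_) t+h≡n)))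
        (≡ₘ.trans (+n-≡ₘ (rowStart i))
          (≡ₘ.sym (≡ₘ.trans (≡⇒≡ₘ (+-comm _ h)) (rowStart-+ i h))))

  fWord-readRows : ∀ i xs → fWord k t (readRows k i xs) ≡ readRows k (i + h) xs
  fWord-readRows i []       = refl
  fWord-readRows i (x ∷ xs) =
    trans (map-++ (shiftRes k t) (readRows k (suc i) xs) (rowWord k i x))
          (cong₂ _++_ (fWord-readRows (suc i) xs) (fWord-rowWord i x))

  long-row-across-wR : 2 ≤ k → ∀ i q → q < h →
    wR (suc i) ++ rowWord k i (q + t) ≈ rowWord k (i + h) (q + t) ++ wR i
  long-row-across-wR 2≤k i q q<h = begin
    wR (suc i) ++ rowWord k i (q + t)
      ≡⟨ cong (wR (suc i) ++_) (++-identityʳ _) ⟨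
    wR (suc i) ++ rowWord k i (q + t) ++ []
      ≡⟨ readRows-replicate t h (suc i) a _ (≡ₘ.trans (rowStart-+ i h) (≡ₘ.sym (rowStart-suc i))) ⟩
    rect t h a (rowWord k i (q + t) ++ [])
      ≡⟨ cong (λ w → rect t h a (w ++ []))
           (trans (rowWord-down i (q + t)) (down-cong (q + t) start≡h+a)) ⟩
    rect t h a (down (q + t) (h + a) ++ [])
      ≈⟨ long-row-across-rect 2≤k t h a q h+t≡n q<h [] ⟩
    down (q + t) a ++ rect t h (suc a) []
      ≡⟨ cong₂ _++_ (rowWord-down (i + h) (q + t)) (readRows-replicate t h i (suc a) [] h+suc-a≡) ⟨
    rowWord k (i + h) (q + t) ++ wR i ++ []
      ≡⟨ cong (rowWord k (i + h) (q + t) ++_) (++-identityʳ (wR i)) ⟩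
    rowWord k (i + h) (q + t) ++ wR i
      ∎
    where
    open ≈-Reasoning
    a = rowStart (i + h)
    start≡h+a : rowStart i ≡ₘ h + a
    start≡h+a = ≡ₘ.sym (rowStart-+ i h)
    h+suc-a≡ : h + suc a ≡ₘ suc (rowStart i)
    h+suc-a≡ = ≡ₘ.trans (≡⇒≡ₘ (+-suc h a)) (+-congˡ-≡ₘ 1 (rowStart-+ i h))

  readRows-addCopies-≤head : ∀ xs → Maybe.All (_≤ t) (head xs) → ∀ i →
    readRows k i (addCopies h t xs) ≡ fWord k t (readRows k i xs) ++ wR i
  readRows-addCopies-≤head xs xs≤t i = begin
    readRows k i (addCopies h t xs)
      ≡⟨ cong (readRows k i) (addCopies-≤head h t xs xs≤t) ⟩
    readRows k i (replicate h t ++ xs)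
      ≡⟨ readRows-++ k i (replicate h t) xs ⟩
    readRows k (i + length (replicate h t)) xs ++ wR i
      ≡⟨ cong (λ j → readRows k (i + j) xs ++ wR i) (length-replicate h) ⟩
    readRows k (i + h) xs ++ wR i
      ≡⟨ cong (_++ wR i) (fWord-readRows i xs) ⟨
    fWord k t (readRows k i xs) ++ wR i
      ∎
    where open ≡-Reasoning

  readRows-addCopies : 1 ≤ t → ∀ xs → All (_≤ k) xs → ∀ i →
    readRows k i (addCopies h t xs) ≈ fWord k t (readRows k i xs) ++ wR i
  readRows-addCopies 1≤t [] _ i = ≡⇒≈ (readRows-addCopies-≤head [] Maybe.nothing i)
  readRows-addCopies 1≤t (p ∷ xs) (p≤k ∷ xs≤k) i with p ≤? t
  ... | yes p≤t = ≡⇒≈ (readRows-addCopies-≤head (p ∷ xs) (Maybe.just p≤t) i)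
  ... | no p≰t with m≤n⇒∃[o]m+o≡n (<⇒≤ (≰⇒> p≰t))
  ...   | q , refl = begin
    readRows k i (addCopies h t (t + q ∷ xs))
      ≡⟨ cong (readRows k i) (addCopies-<head h t (t + q) xs t<p) ⟩
    readRows k (suc i) (addCopies h t xs) ++ rowWord k i (t + q)
      ≈⟨ ++-congʳ (rowWord k i (t + q)) (readRows-addCopies 1≤t xs xs≤k (suc i)) ⟩
    (F ++ wR (suc i)) ++ rowWord k i (t + q)
      ≡⟨ trans (++-assoc F _ _) (cong (λ m → F ++ wR (suc i) ++ rowWord k i m) (+-comm t q)) ⟩
    F ++ wR (suc i) ++ rowWord k i (q + t)
      ≈⟨ ++-congˡ F (long-row-across-wR 2≤k i q q<h) ⟩
    F ++ rowWord k (i + h) (q + t) ++ wR i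
      ≡⟨ cong (λ m → F ++ rowWord k (i + h) m ++ wR i) (+-comm q t) ⟩
    F ++ rowWord k (i + h) (t + q) ++ wR i
      ≡⟨ cong (_++ rowWord k (i + h) (t + q) ++ wR i) (fWord-readRows (suc i) xs) ⟩
    readRows k (suc i + h) xs ++ rowWord k (i + h) (t + q) ++ wR i
      ≡⟨ trans (cong (_++ wR i) (fWord-readRows i (t + q ∷ xs)))
               (++-assoc (readRows k (suc i + h) xs) _ _) ⟨
    fWord k t (readRows k i (t + q ∷ xs)) ++ wR i
      ∎
    where
    open ≈-Reasoning
    t<p = ≰⇒> p≰t
    F = fWord k t (readRows k (suc i) xs)
    2≤k : 2 ≤ k
    2≤k = ≤-trans (s≤s 1≤t) (≤-trans t<p p≤k)
    q<h : q < h
    q<h = +-cancelˡ-< t q h (subst (t + q <_) (sym t+h≡n) (s≤s p≤k))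

lemma2p15 : (k t : ℕ) → 1 ≤ t → t ≤ k → (λ' : List ℕ) → IsKPartition k λ' →
    wOf k (RUnion k t λ') ≈[ k ] (fWord k t (wOf k λ') ++ wOf k (R k t))
lemma2p15 k t 1≤t t≤k λ' (_ , parts) = begin
  wOf k (RUnion k t λ')
    ≈⟨ readRows-addCopies 1≤t λ' (All.map proj₂ parts) 1 ⟩
  fWord k t (wOf k λ') ++ wR 1
    ≡⟨ cong (λ w → fWord k t (wOf k λ') ++ readRows k 1 w) R-replicate ⟨
  fWord k t (wOf k λ') ++ wOf k (R k t)
    ∎
  where
  h = suc k ∸ t
  open Words k
  open ≈-Reasoning
  open Rectangle k t h (m+[n∸m]≡n (m≤n⇒m≤1+n t≤k))
  R-replicate : R k t ≡ replicate h t
  R-replicate = trans (addCopies-≤head h t [] Maybe.nothing) (++-identityʳ _)
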